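{- Let $H \in \mathbb{N}$ have Zeckendorf expansion \[ H = F_{m_0} + F_{m_1} + \cdots + F_{m_k}, \] where $k \ge 0$, $m_{i-1} - m_i \ge 2$ for $1 \le i \le k$, and $m_k \ge 2$. Write \[ x_\ell = F_{m_\ell} + \cdots + F_{m_k} \quad (0 \le \ell \le k+1) \] (so $x_{k+1} = 0$), and \[ t_i = \Big\lfloor \frac{m_{i-1} - m_i + 2}{2} \Big\rfloor, \qquad \varepsilon_i = 2t_i - 1 - m_{i-1} + m_i \qquad (1 \le i \le k). \] Let \[ a_0 = 1, \qquad a_1 = t_1, \qquad a_{\ell+1} = t_{\ell+1} a_\ell - \varepsilon_\ell a_{\ell-1} \quad (1 \le \ell \le k-1). \] Then \[ R(H) = \begin{cases} a_k \lfloor m_k/2 \rfloor - \varepsilon_k a_{k-1}, & \text{if } k \ge 1,\\ \lfloor m_0/2 \rfloor, & \text{if } k = 0. \end{cases} \]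
   Context: The Fibonacci numbers are $F_1 = F_2 = 1$, $F_{m+1} = F_m + F_{m-1}$. For $n \in \mathbb{Z}_{\ge 0}$, $R(n)$ is the number of solutions to $x_1 + \cdots + x_s = n$ with $s \in \mathbb{Z}_{\ge 0}$ and $x_1 < x_2 < \cdots < x_s$ Fibonacci numbers (i.e. the number of partitions of $n$ into distinct Fibonacci numbers; $R(0) = 1$). The Zeckendorf expansion of a positive integer is its unique representation as a sum of non-consecutive Fibonacci numbers $F_{m}$ with indices $m \ge 2$. Empty sums are $0$. -}

module Defs where

open import Data.Nat using (ℕ; zero; suc; _+_; _∸_; _/_; _≟_)
open import Data.List using (List; []; _∷_; [_]; map; _++_; length; filter; upTo)
open import Data.Nat.ListAction using (sum)
open import Data.Integer as ℤ using (ℤ; +_)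

F : ℕ → ℕ
F zero = 0
F (suc zero) = 1
F (suc (suc n)) = F (suc n) + F n

subsets : List ℕ → List (List ℕ)
subsets [] = [ [] ]
subsets (x ∷ xs) = map (x ∷_) (subsets xs) ++ subsets xs

-- The distinct Fibonacci values F 2 < F 3 < ... < F (n+2); F (n+2) > n,
-- so this contains every Fibonacci number that can occur as a part of n.
fibsUpTo : ℕ → List ℕ
fibsUpTo n = map (λ i → F (i + 2)) (upTo (suc n))

-- R n : number of partitions of n into distinct Fibonacci numbers
-- (= number of subsets of the distinct Fibonacci values summing to n).
R : ℕ → ℕ
R n = length (filter (λ xs → sum xs ≟ n) (subsets (fibsUpTo n)))

sumF : (ℕ → ℕ) → ℕ → ℕ
sumF m zero = F (m 0)
sumF m (suc k) = sumF m k + F (m (suc k))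

t : (ℕ → ℕ) → ℕ → ℤ
t m zero = + 0
t m (suc i) = + ((m i ∸ m (suc i) + 2) / 2)

ε : (ℕ → ℕ) → ℕ → ℤ
ε m zero = + 0
ε m (suc i) = (+ 2) ℤ.* t m (suc i) ℤ.- (+ 1) ℤ.- (+ m i) ℤ.+ (+ m (suc i))

a : (ℕ → ℕ) → ℕ → ℤ
a m zero = + 1
a m (suc zero) = t m 1
a m (suc (suc l)) = t m (suc (suc l)) ℤ.* a m (suc l) ℤ.- ε m (suc l) ℤ.* a m l

formula : (ℕ → ℕ) → ℕ → ℤ
formula m zero = + (m 0 / 2)
formula m (suc j) = a m (suc j) ℤ.* (+ (m (suc j) / 2)) ℤ.- ε m (suc j) ℤ.* a m j

{-# OPTIONS --safe #-}
-- Count the representations of F q + x with all parts ≤ F q.  Peeling off the two largest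
-- parts gives repsTop (q + 2) x = R x + repsTop q x, and for x = F p + y with y < F (p − 1)
-- one has repsTop p x = R x − R y and repsTop (p + 1) x = R x.  Hence for q ≥ p + 2,
-- R (F q + x) = repsTop q x = ⌊(q − p + 2)/2⌋ R x − ε R y, where ε is 1 if q − p is even
-- and 0 otherwise.  Along the tails x_ℓ of the Zeckendorf expansion this is the three-term
-- recurrence R x_{ℓ−1} = t_ℓ R x_ℓ − ε_ℓ R x_{ℓ+1}, which the continuants a_ℓ unroll down
-- to x_k = F (m k), where R (F q) = ⌊q/2⌋.

module Submission where

open import Defs
open import Data.Nat using (ℕ; zero; suc; pred; _+_; _∸_; _/_; _≟_; _≤_; _<_; _≤′_; ≤′-refl; ≤′-step; z≤n; s≤s)
open import Data.Nat.Properties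
open import Data.Nat.DivMod using (m/n≡1+[m∸n]/n)
open import Data.Nat.ListAction using (sum)
open import Data.Integer as ℤ using (ℤ; +_)
import Data.Integer.Tactic.RingSolver as ℤ-Ring
open import Data.List using (List; []; _∷_; [_]; _++_; map; length; filter; upTo)
open import Data.List.Properties using (filter-accept; filter-reject; filter-++; length-++; applyUpTo-∷ʳ; map-++)
open import Algebra.Properties.CommutativeSemigroup +-commutativeSemigroup using (interchange)
open import Data.Product using (_,_)
open import Data.Sum using (inj₁; inj₂)
open import Relation.Nullary using (yes; no)
open import Relation.Binary.PropositionalEquality hiding ([_])
open import Function using (_∘_)

-- Counting subsets by their sum

-- shift x n f is f (n ∸ x) if x ≤ n and 0 otherwise: the coefficient of zⁿ in zˣ · Σ f k zᵏ.
shift : ℕ → ℕ → (ℕ → ℕ) → ℕ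
shift zero    n       f = f n
shift (suc x) zero    f = 0
shift (suc x) (suc n) f = shift x n f

shift-hit : ∀ x n f → shift x (x + n) f ≡ f n
shift-hit zero    n f = refl
shift-hit (suc x) n f = shift-hit x n f

shift-miss : ∀ {x n} f → n < x → shift x n f ≡ 0
shift-miss {suc x} {zero}  f _         = refl
shift-miss {suc x} {suc n} f (s≤s n<x) = shift-miss f n<x

shift-vanish : ∀ x n f → (∀ k → x + k ≡ n → f k ≡ 0) → shift x n f ≡ 0
shift-vanish zero    n       f f≡0 = f≡0 n refl
shift-vanish (suc x) zero    f f≡0 = refl
shift-vanish (suc x) (suc n) f f≡0 = shift-vanish x n f (λ k e → f≡0 k (cong suc e))

shift-cong : ∀ x n {f g} → (∀ k → f k ≡ g k) → shift x n f ≡ shift x n g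
shift-cong zero    n       f≗g = f≗g n
shift-cong (suc x) zero    f≗g = refl
shift-cong (suc x) (suc n) f≗g = shift-cong x n f≗g

shift-+ : ∀ x n f g → shift x n (λ k → f k + g k) ≡ shift x n f + shift x n g
shift-+ zero    n       f g = refl
shift-+ (suc x) zero    f g = refl
shift-+ (suc x) (suc n) f g = shift-+ x n f g

shift-shift : ∀ x y n f → shift x n (λ k → shift y k f) ≡ shift (x + y) n f
shift-shift zero    y n       f = refl
shift-shift (suc x) y zero    f = refl
shift-shift (suc x) y (suc n) f = shift-shift x y n f

shift-comm : ∀ x y n f → shift x n (λ k → shift y k f) ≡ shift y n (λ k → shift x k f)
shift-comm x y n f = begin
  shift x n (λ k → shift y k f) ≡⟨ shift-shift x y n f ⟩
  shift (x + y) n f             ≡⟨ cong (λ z → shift z n f) (+-comm x y) ⟩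
  shift (y + x) n f             ≡⟨ shift-shift y x n f ⟨
  shift y n (λ k → shift x k f) ∎
  where open ≡-Reasoning

countSum : ℕ → List (List ℕ) → ℕ
countSum n S = length (filter (λ xs → sum xs ≟ n) S)

countSum-++ : ∀ n S T → countSum n (S ++ T) ≡ countSum n S + countSum n T
countSum-++ n S T = trans (cong length (filter-++ (λ xs → sum xs ≟ n) S T)) (length-++ (filter (λ xs → sum xs ≟ n) S))

countSum-accept : ∀ {n} s S → sum s ≡ n → countSum n (s ∷ S) ≡ suc (countSum n S)
countSum-accept {n} s S e = cong length (filter-accept (λ xs → sum xs ≟ n) {x = s} {xs = S} e)

countSum-reject : ∀ {n} s S → sum s ≢ n → countSum n (s ∷ S) ≡ countSum n S
countSum-reject {n} s S ne = cong length (filter-reject (λ xs → sum xs ≟ n) {x = s} {xs = S} ne)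

countSum-map-∷ : ∀ x n S → countSum (x + n) (map (x ∷_) S) ≡ countSum n S
countSum-map-∷ x n [] = refl
countSum-map-∷ x n (s ∷ S) with sum s ≟ n
... | yes e = trans (countSum-accept (x ∷ s) (map (x ∷_) S) (cong (λ z → x + z) e))
                    (trans (cong suc (countSum-map-∷ x n S)) (sym (countSum-accept s S e)))
... | no ne = trans (countSum-reject (x ∷ s) (map (x ∷_) S) (ne ∘ +-cancelˡ-≡ x _ _))
                    (trans (countSum-map-∷ x n S) (sym (countSum-reject s S ne)))

countSum-map-∷-< : ∀ x n S → n < x → countSum n (map (x ∷_) S) ≡ 0
countSum-map-∷-< x n [] n<x = refl
countSum-map-∷-< x n (s ∷ S) n<x =
  trans (countSum-reject (x ∷ s) (map (x ∷_) S) (λ e → <⇒≱ n<x (subst (x ≤_) e (m≤m+n x (sum s)))))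
        (countSum-map-∷-< x n S n<x)

countSum-map-∷-shift : ∀ x n S → countSum n (map (x ∷_) S) ≡ shift x n (λ k → countSum k S)
countSum-map-∷-shift x n S with ≤-<-connex x n
... | inj₂ n<x = trans (countSum-map-∷-< x n S n<x) (sym (shift-miss _ n<x))
... | inj₁ x≤n with m≤n⇒∃[o]m+o≡n x≤n
...   | k , refl = trans (countSum-map-∷ x k S) (sym (shift-hit x k _))

subsetSums : List ℕ → ℕ → ℕ
subsetSums L n = countSum n (subsets L)

subsetSums-∷ : ∀ x L n → subsetSums (x ∷ L) n ≡ shift x n (subsetSums L) + subsetSums L n
subsetSums-∷ x L n = trans (countSum-++ n (map (x ∷_) (subsets L)) (subsets L))
  (cong (_+ subsetSums L n) (countSum-map-∷-shift x n (subsets L)))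

subsetSums-swap : ∀ x y L n → subsetSums (x ∷ y ∷ L) n ≡ subsetSums (y ∷ x ∷ L) n
subsetSums-swap x y L n = begin
  subsetSums (x ∷ y ∷ L) n
    ≡⟨ subsetSums-∷ x (y ∷ L) n ⟩
  shift x n (subsetSums (y ∷ L)) + subsetSums (y ∷ L) n
    ≡⟨ cong₂ _+_ (trans (shift-cong x n (subsetSums-∷ y L)) (shift-+ x n _ _)) (subsetSums-∷ y L n) ⟩
  (shift x n (λ k → shift y k S) + shift x n S) + (shift y n S + S n)
    ≡⟨ cong (λ z → (z + shift x n S) + (shift y n S + S n)) (shift-comm x y n S) ⟩
  (shift y n (λ k → shift x k S) + shift x n S) + (shift y n S + S n)
    ≡⟨ interchange (shift y n (λ k → shift x k S)) (shift x n S) (shift y n S) (S n) ⟩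
  (shift y n (λ k → shift x k S) + shift y n S) + (shift x n S + S n)
    ≡⟨ cong₂ _+_ (trans (shift-cong y n (subsetSums-∷ x L)) (shift-+ y n _ _)) (subsetSums-∷ x L n) ⟨
  shift y n (subsetSums (x ∷ L)) + subsetSums (x ∷ L) n
    ≡⟨ subsetSums-∷ y (x ∷ L) n ⟨
  subsetSums (y ∷ x ∷ L) n ∎
  where
  open ≡-Reasoning
  S = subsetSums L

subsetSums-∷ʳ : ∀ y L n → subsetSums (L ++ [ y ]) n ≡ subsetSums (y ∷ L) n
subsetSums-∷ʳ y []      n = refl
subsetSums-∷ʳ y (x ∷ L) n = begin
  subsetSums (x ∷ L ++ [ y ]) n
    ≡⟨ subsetSums-∷ x (L ++ [ y ]) n ⟩
  shift x n (subsetSums (L ++ [ y ])) + subsetSums (L ++ [ y ]) n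
    ≡⟨ cong₂ _+_ (shift-cong x n (subsetSums-∷ʳ y L)) (subsetSums-∷ʳ y L n) ⟩
  shift x n (subsetSums (y ∷ L)) + subsetSums (y ∷ L) n
    ≡⟨ subsetSums-∷ x (y ∷ L) n ⟨
  subsetSums (x ∷ y ∷ L) n
    ≡⟨ subsetSums-swap x y L n ⟩
  subsetSums (y ∷ x ∷ L) n ∎
  where open ≡-Reasoning

-- Partitions into distinct Fibonacci numbers

F-≤-suc : ∀ n → F n ≤ F (suc n)
F-≤-suc zero          = z≤n
F-≤-suc (suc zero)    = ≤-refl
F-≤-suc (suc (suc n)) = m≤m+n _ _

F-mono : ∀ {i j} → i ≤ j → F i ≤ F j
F-mono i≤j = go (≤⇒≤′ i≤j)
  where
  go : ∀ {i j} → i ≤′ j → F i ≤ F j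
  go ≤′-refl       = ≤-refl
  go (≤′-step {j} i≤j) = ≤-trans (go i≤j) (F-≤-suc j)

F-pos : ∀ n → 0 < F (suc n)
F-pos zero    = ≤-refl
F-pos (suc n) = ≤-trans (F-pos n) (m≤m+n _ _)

n<F[2+n] : ∀ n → n < F (2 + n)
n<F[2+n] zero    = ≤-refl
n<F[2+n] (suc n) = subst (_≤ F (3 + n)) (+-comm (suc n) 1) (+-mono-≤ (n<F[2+n] n) (F-pos n))

-- reps j n counts the sets of distinct parts among F 2, F 3, …, F (1 + j) with sum n.
reps : ℕ → ℕ → ℕ
reps zero    zero    = 1
reps zero    (suc _) = 0
reps (suc j) n       = shift (F (2 + j)) n (reps j) + reps j n

fibs : ℕ → List ℕ
fibs j = map (λ i → F (i + 2)) (upTo j)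

subsetSums-fibs : ∀ j n → subsetSums (fibs j) n ≡ reps j n
subsetSums-fibs zero    zero    = refl
subsetSums-fibs zero    (suc n) = refl
subsetSums-fibs (suc j) n = begin
  subsetSums (fibs (suc j)) n
    ≡⟨ cong (λ L → subsetSums L n) fibs-suc ⟩
  subsetSums (fibs j ++ [ F (j + 2) ]) n
    ≡⟨ subsetSums-∷ʳ (F (j + 2)) (fibs j) n ⟩
  subsetSums (F (j + 2) ∷ fibs j) n
    ≡⟨ subsetSums-∷ (F (j + 2)) (fibs j) n ⟩
  shift (F (j + 2)) n (subsetSums (fibs j)) + subsetSums (fibs j) n
    ≡⟨ cong₂ _+_ (shift-cong (F (j + 2)) n (subsetSums-fibs j)) (subsetSums-fibs j n) ⟩
  shift (F (j + 2)) n (reps j) + reps j n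
    ≡⟨ cong (λ i → shift (F i) n (reps j) + reps j n) (+-comm j 2) ⟩
  reps (suc j) n ∎
  where
  open ≡-Reasoning
  fibs-suc : fibs (suc j) ≡ fibs j ++ [ F (j + 2) ]
  fibs-suc = trans (cong (map (λ i → F (i + 2))) (sym (applyUpTo-∷ʳ (λ i → i) j)))
                   (map-++ (λ i → F (i + 2)) (upTo j) [ j ])

R≡reps : ∀ n → R n ≡ reps (suc n) n
R≡reps n = subsetSums-fibs (suc n) n

reps-hit : ∀ j n → reps (suc j) (F (2 + j) + n) ≡ reps j n + reps j (F (2 + j) + n)
reps-hit j n = cong (_+ reps j (F (2 + j) + n)) (shift-hit (F (2 + j)) n (reps j))

reps-stable : ∀ {i j n} → n < F (2 + i) → i ≤′ j → reps j n ≡ reps i n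
reps-stable n<F ≤′-refl = refl
reps-stable {n = n} n<F (≤′-step {j} i≤j) =
  trans (cong (_+ reps j n) (shift-miss (reps j) (<-≤-trans n<F (F-mono (s≤s (s≤s (≤′⇒≤ i≤j)))))))
        (reps-stable n<F i≤j)

R≡reps-of-< : ∀ j {n} → n < F (2 + j) → R n ≡ reps j n
R≡reps-of-< j {n} n<F with ≤-total j (suc n)
... | inj₁ j≤1+n = trans (R≡reps n) (reps-stable n<F (≤⇒≤′ j≤1+n))
... | inj₂ 1+n≤j = trans (R≡reps n) (sym (reps-stable n<F[3+n] (≤⇒≤′ 1+n≤j)))
  where
  n<F[3+n] : n < F (3 + n)
  n<F[3+n] = <-≤-trans (n<F[2+n] n) (F-≤-suc (2 + n))

reps-vanish : ∀ j n → F (3 + j) ≤ n → reps j n ≡ 0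
reps-vanish zero    (suc n) _   = refl
reps-vanish (suc j) n       F≤n = cong₂ _+_ large-part (reps-vanish j n (≤-trans (F-≤-suc (3 + j)) F≤n))
  where
  large-part : shift (F (2 + j)) n (reps j) ≡ 0
  large-part = shift-vanish (F (2 + j)) n (reps j) λ k e →
    reps-vanish j k (+-cancelˡ-≤ (F (2 + j)) _ _
      (subst (F (2 + j) + F (3 + j) ≤_) (sym e) (subst (_≤ n) (+-comm (F (3 + j)) _) F≤n)))

-- A three-term recurrence for R

-- repsTop q x counts the representations of F q + x with all parts ≤ F q (the value at q = 0 is junk).
repsTop : ℕ → ℕ → ℕ
repsTop zero    _ = 0
repsTop (suc j) x = reps j (F (suc j) + x)

-- A representation of F (2 + q) + x without the part F (2 + q) must contain F (1 + q),
-- since F 2 + ⋯ + F q = F (2 + q) ∸ 2.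
repsTop-step : ∀ q x → 1 ≤ q → x < F (2 + q) → repsTop (2 + q) x ≡ R x + repsTop q x
repsTop-step (suc j) x _ x<F = begin
  reps (2 + j) (F (3 + j) + x)
    ≡⟨ reps-hit (suc j) x ⟩
  reps (1 + j) x + reps (1 + j) (F (3 + j) + x)
    ≡⟨ cong₂ _+_ (sym (R≡reps-of-< (suc j) x<F)) (cong (reps (1 + j)) (+-assoc (F (2 + j)) (F (1 + j)) x)) ⟩
  R x + reps (1 + j) (F (2 + j) + (F (1 + j) + x))
    ≡⟨ cong (λ z → R x + z) (reps-hit j (F (1 + j) + x)) ⟩
  R x + (repsTop (suc j) x + reps j (F (2 + j) + (F (1 + j) + x)))
    ≡⟨ cong (λ z → R x + (repsTop (suc j) x + z)) (reps-vanish j _ (+-monoʳ-≤ (F (2 + j)) (m≤m+n (F (1 + j)) x))) ⟩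
  R x + (repsTop (suc j) x + 0)
    ≡⟨ cong (λ z → R x + z) (+-identityʳ _) ⟩
  R x + repsTop (suc j) x ∎
  where open ≡-Reasoning

repsTop-zero : ∀ q → 2 ≤ q → repsTop q 0 ≡ q / 2
repsTop-zero zero                      ()
repsTop-zero (suc zero)                (s≤s ())
repsTop-zero (suc (suc zero))          _ = refl
repsTop-zero (suc (suc (suc zero)))    _ = refl
repsTop-zero (suc (suc (suc (suc q)))) _ = begin
  repsTop (4 + q) 0       ≡⟨ repsTop-step (2 + q) 0 (s≤s z≤n) (F-pos (3 + q)) ⟩
  1 + repsTop (2 + q) 0   ≡⟨ cong suc (repsTop-zero (suc (suc q)) (s≤s (s≤s z≤n))) ⟩
  1 + (2 + q) / 2   ≡⟨ m/n≡1+[m∸n]/n {4 + q} {2} (s≤s (s≤s z≤n)) ⟨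
  (4 + q) / 2       ∎
  where open ≡-Reasoning

R-F : ∀ q → 2 ≤ q → R (F q) ≡ q / 2
R-F zero          ()
R-F (suc zero)    (s≤s ())
R-F (suc (suc r)) 2≤q = begin
  R (F (2 + r))      ≡⟨ cong R (+-identityʳ (F (2 + r))) ⟨
  R (F (2 + r) + 0)  ≡⟨ R≡reps-of-< (suc r) (+-monoʳ-< (F (2 + r)) (F-pos r)) ⟩
  repsTop (2 + r) 0        ≡⟨ repsTop-zero (2 + r) 2≤q ⟩
  (2 + r) / 2        ∎
  where open ≡-Reasoning

module _ (r y : ℕ) (y<F : y < F (suc r)) where
  private
    x = F (2 + r) + y

  x<F : x < F (3 + r)
  x<F = +-monoʳ-< (F (2 + r)) y<F

  repsTop-base₀ : repsTop (2 + r) x + R y ≡ R x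
  repsTop-base₀ = begin
    reps (1 + r) (F (2 + r) + x) + R y
      ≡⟨ cong (_+ R y) (reps-hit r x) ⟩
    (reps r x + reps r (F (2 + r) + x)) + R y
      ≡⟨ cong (λ z → (reps r x + z) + R y) (reps-vanish r _ F[3+r]≤) ⟩
    (reps r x + 0) + R y
      ≡⟨ cong₂ _+_ (+-identityʳ _) (R≡reps-of-< r (<-≤-trans y<F (F-≤-suc (suc r)))) ⟩
    reps r x + reps r y
      ≡⟨ +-comm (reps r x) _ ⟩
    reps r y + reps r x
      ≡⟨ reps-hit r y ⟨
    reps (1 + r) x
      ≡⟨ R≡reps-of-< (suc r) x<F ⟨
    R x ∎
    where
    open ≡-Reasoning
    F[3+r]≤ : F (3 + r) ≤ F (2 + r) + x
    F[3+r]≤ = +-monoʳ-≤ (F (2 + r)) (≤-trans (F-≤-suc (suc r)) (m≤m+n (F (2 + r)) y))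

  repsTop-base₁ : repsTop (3 + r) x ≡ R x
  repsTop-base₁ = begin
    reps (2 + r) (F (3 + r) + x)
      ≡⟨ reps-hit (suc r) x ⟩
    reps (1 + r) x + reps (1 + r) (F (3 + r) + x)
      ≡⟨ cong₂ _+_ (sym (R≡reps-of-< (suc r) x<F)) (reps-vanish (suc r) _ (+-monoʳ-≤ (F (3 + r)) (m≤m+n (F (2 + r)) y))) ⟩
    R x + 0
      ≡⟨ +-identityʳ _ ⟩
    R x ∎
    where open ≡-Reasoning

-- 2 ⌊(k + 2)/2⌋ − 1 − k is 1 for even k and 0 for odd k.
twoStep-closed : (g : ℕ → ℕ) (r s : ℕ) → g 0 + s ≡ r → g 1 ≡ r → (∀ k → g (2 + k) ≡ r + g k) →
  ∀ k → + g k ≡ + ((k + 2) / 2) ℤ.* + r ℤ.- ((+ 2) ℤ.* + ((k + 2) / 2) ℤ.- + 1 ℤ.- + k) ℤ.* + s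
twoStep-closed g r s g₀ g₁ g-step = closed
  where
  base₀ : ∀ a b → a ≡ (a ℤ.+ b) ℤ.- b
  base₀ = ℤ-Ring.solve-∀
  base : ∀ r s → r ℤ.- s ≡ + 1 ℤ.* r ℤ.- ((+ 2) ℤ.* + 1 ℤ.- + 1 ℤ.- + 0) ℤ.* s
  base = ℤ-Ring.solve-∀
  base₁ : ∀ r s → r ≡ + 1 ℤ.* r ℤ.- ((+ 2) ℤ.* + 1 ℤ.- + 1 ℤ.- + 1) ℤ.* s
  base₁ = ℤ-Ring.solve-∀
  step : ∀ r h k s → r ℤ.+ (h ℤ.* r ℤ.- ((+ 2) ℤ.* h ℤ.- + 1 ℤ.- k) ℤ.* s)
                   ≡ (+ 1 ℤ.+ h) ℤ.* r ℤ.- ((+ 2) ℤ.* (+ 1 ℤ.+ h) ℤ.- + 1 ℤ.- (+ 2 ℤ.+ k)) ℤ.* s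
  step = ℤ-Ring.solve-∀
  closed : ∀ k → + g k ≡ + ((k + 2) / 2) ℤ.* + r ℤ.- ((+ 2) ℤ.* + ((k + 2) / 2) ℤ.- + 1 ℤ.- + k) ℤ.* + s
  closed zero = trans (base₀ (+ g 0) (+ s)) (trans (cong (λ n → + n ℤ.- + s) g₀) (base (+ r) (+ s)))
  closed (suc zero) = trans (cong +_ g₁) (base₁ (+ r) (+ s))
  closed (suc (suc k)) = begin
    + g (2 + k)
      ≡⟨ cong +_ (g-step k) ⟩
    + r ℤ.+ + g k
      ≡⟨ cong (λ z → + r ℤ.+ z) (closed k) ⟩
    + r ℤ.+ (+ h ℤ.* + r ℤ.- ((+ 2) ℤ.* + h ℤ.- + 1 ℤ.- + k) ℤ.* + s)
      ≡⟨ step (+ r) (+ h) (+ k) (+ s) ⟩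
    + suc h ℤ.* + r ℤ.- ((+ 2) ℤ.* + suc h ℤ.- + 1 ℤ.- + (2 + k)) ℤ.* + s
      ≡⟨ cong (λ h′ → + h′ ℤ.* + r ℤ.- ((+ 2) ℤ.* + h′ ℤ.- + 1 ℤ.- + (2 + k)) ℤ.* + s)
              (sym (m/n≡1+[m∸n]/n {2 + k + 2} {2} (s≤s (s≤s z≤n)))) ⟩
    + ((2 + k + 2) / 2) ℤ.* + r ℤ.- ((+ 2) ℤ.* + ((2 + k + 2) / 2) ℤ.- + 1 ℤ.- + (2 + k)) ℤ.* + s ∎
    where
    open ≡-Reasoning
    h = (k + 2) / 2

F[p∸1]>0 : ∀ {p} → 2 ≤ p → 0 < F (p ∸ 1)
F[p∸1]>0 {suc (suc r)} _ = F-pos r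
F[p∸1]>0 {suc zero} (s≤s ())

zeckendorf-step : ∀ p q y → 2 ≤ p → p + 2 ≤ q → y < F (p ∸ 1) → F p + y < F (q ∸ 1)
zeckendorf-step (suc (suc r)) (suc (suc q′)) y _ (s≤s (s≤s r+2≤q′)) y<F =
  <-≤-trans (+-monoʳ-< (F (2 + r)) y<F) (F-mono (s≤s (subst (_≤ q′) (+-comm r 2) r+2≤q′)))

R-recurrence : ∀ p q y → 2 ≤ p → p + 2 ≤ q → y < F (p ∸ 1) →
  + R (F q + (F p + y)) ≡
    + ((q ∸ p + 2) / 2) ℤ.* + R (F p + y) ℤ.- ((+ 2) ℤ.* + ((q ∸ p + 2) / 2) ℤ.- + 1 ℤ.- + q ℤ.+ + p) ℤ.* + R y
R-recurrence p@(suc (suc r)) q@(suc (suc q′)) y 2≤p p+2≤q@(s≤s (s≤s _)) y<F = begin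
  + R (F q + x)
    ≡⟨ cong +_ (R≡reps-of-< (suc q′) (+-monoʳ-< (F q) (zeckendorf-step p q y 2≤p p+2≤q y<F))) ⟩
  + repsTop q x
    ≡⟨ cong (λ i → + repsTop i x) q≡k+p ⟩
  + repsTop (k + p) x
    ≡⟨ twoStep-closed (λ i → repsTop (i + p) x) (R x) (R y) (repsTop-base₀ r y y<F) (repsTop-base₁ r y y<F)
         (λ i → repsTop-step (i + p) x (≤-trans (s≤s z≤n) (m≤n+m p i)) (x<F[2+i+p] i)) k ⟩
  + T ℤ.* + R x ℤ.- ((+ 2) ℤ.* + T ℤ.- + 1 ℤ.- + k) ℤ.* + R y
    ≡⟨ regroup-ε (+ T) (+ k) (+ p) (+ R x) (+ R y) ⟩
  + T ℤ.* + R x ℤ.- ((+ 2) ℤ.* + T ℤ.- + 1 ℤ.- + (k + p) ℤ.+ + p) ℤ.* + R y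
    ≡⟨ cong (λ i → + T ℤ.* + R x ℤ.- ((+ 2) ℤ.* + T ℤ.- + 1 ℤ.- + i ℤ.+ + p) ℤ.* + R y) (sym q≡k+p) ⟩
  + T ℤ.* + R x ℤ.- ((+ 2) ℤ.* + T ℤ.- + 1 ℤ.- + q ℤ.+ + p) ℤ.* + R y ∎
  where
  open ≡-Reasoning
  x = F p + y
  k = q ∸ p
  T = (k + 2) / 2
  x<F[2+i+p] : ∀ i → x < F (2 + (i + p))
  x<F[2+i+p] i = <-≤-trans (x<F r y y<F) (F-mono (s≤s (s≤s (≤-trans (n≤1+n (suc r)) (m≤n+m p i)))))
  q≡k+p : q ≡ k + p
  q≡k+p = sym (m∸n+n≡m (≤-trans (m≤m+n p 2) p+2≤q))
  regroup-ε : ∀ T k p a b → T ℤ.* a ℤ.- ((+ 2) ℤ.* T ℤ.- + 1 ℤ.- k) ℤ.* b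
                       ≡ T ℤ.* a ℤ.- ((+ 2) ℤ.* T ℤ.- + 1 ℤ.- (k ℤ.+ p) ℤ.+ p) ℤ.* b
  regroup-ε = ℤ-Ring.solve-∀

-- Continuants and Zeckendorf tails

a-rec : ∀ m ℓ → a m (suc ℓ) ≡ t m (suc ℓ) ℤ.* a m ℓ ℤ.- ε m ℓ ℤ.* a m (pred ℓ)
a-rec m zero    = unit (t m 1)
  where
  unit : ∀ t → t ≡ t ℤ.* + 1 ℤ.- + 0 ℤ.* + 1
  unit = ℤ-Ring.solve-∀
a-rec m (suc ℓ) = refl

a-expansion : ∀ m (u : ℕ → ℤ) ℓ →
  (∀ i → i < ℓ → u i ≡ t m (suc i) ℤ.* u (suc i) ℤ.- ε m (suc i) ℤ.* u (suc (suc i))) →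
  u 0 ≡ a m ℓ ℤ.* u ℓ ℤ.- ε m ℓ ℤ.* a m (pred ℓ) ℤ.* u (suc ℓ)
a-expansion m u zero    _   = unit (u 0) (u 1)
  where
  unit : ∀ u₀ u₁ → u₀ ≡ + 1 ℤ.* u₀ ℤ.- + 0 ℤ.* + 1 ℤ.* u₁
  unit = ℤ-Ring.solve-∀
a-expansion m u (suc ℓ) rec = begin
  u 0
    ≡⟨ a-expansion m u ℓ (λ i i<ℓ → rec i (m<n⇒m<1+n i<ℓ)) ⟩
  a m ℓ ℤ.* u ℓ ℤ.- ε m ℓ ℤ.* a m (pred ℓ) ℤ.* u (suc ℓ)
    ≡⟨ cong (λ v → a m ℓ ℤ.* v ℤ.- ε m ℓ ℤ.* a m (pred ℓ) ℤ.* u (suc ℓ)) (rec ℓ ≤-refl) ⟩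
  _
    ≡⟨ regroup (a m ℓ) (t m (suc ℓ)) (ε m (suc ℓ)) (ε m ℓ) (a m (pred ℓ)) (u (suc ℓ)) (u (2 + ℓ)) ⟩
  (t m (suc ℓ) ℤ.* a m ℓ ℤ.- ε m ℓ ℤ.* a m (pred ℓ)) ℤ.* u (suc ℓ) ℤ.- ε m (suc ℓ) ℤ.* a m ℓ ℤ.* u (2 + ℓ)
    ≡⟨ cong (λ v → v ℤ.* u (suc ℓ) ℤ.- ε m (suc ℓ) ℤ.* a m ℓ ℤ.* u (2 + ℓ)) (a-rec m ℓ) ⟨
  a m (suc ℓ) ℤ.* u (suc ℓ) ℤ.- ε m (suc ℓ) ℤ.* a m ℓ ℤ.* u (2 + ℓ) ∎
  where
  open ≡-Reasoning
  regroup : ∀ a t e e′ a′ u₁ u₂ → a ℤ.* (t ℤ.* u₁ ℤ.- e ℤ.* u₂) ℤ.- e′ ℤ.* a′ ℤ.* u₁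
                                ≡ (t ℤ.* a ℤ.- e′ ℤ.* a′) ℤ.* u₁ ℤ.- e ℤ.* a ℤ.* u₂
  regroup = ℤ-Ring.solve-∀

formula≡ : ∀ m k → a m k ℤ.* + (m k / 2) ℤ.- ε m k ℤ.* a m (pred k) ℤ.* + 1 ≡ formula m k
formula≡ m zero    = unit (+ (m 0 / 2))
  where
  unit : ∀ h → + 1 ℤ.* h ℤ.- + 0 ℤ.* + 1 ℤ.* + 1 ≡ h
  unit = ℤ-Ring.solve-∀
formula≡ m (suc j) = drop-one (a m (suc j)) (+ (m (suc j) / 2)) (ε m (suc j)) (a m j)
  where
  drop-one : ∀ a h e a′ → a ℤ.* h ℤ.- e ℤ.* a′ ℤ.* + 1 ≡ a ℤ.* h ℤ.- e ℤ.* a′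
  drop-one = ℤ-Ring.solve-∀

sumFrom : (ℕ → ℕ) → ℕ → ℕ → ℕ
sumFrom m ℓ zero    = 0
sumFrom m ℓ (suc n) = F (m ℓ) + sumFrom m (suc ℓ) n

sumFrom-suc : ∀ m ℓ n → sumFrom m ℓ (suc n) ≡ sumFrom m ℓ n + F (m (ℓ + n))
sumFrom-suc m ℓ zero    = trans (+-identityʳ _) (cong (F ∘ m) (sym (+-identityʳ ℓ)))
sumFrom-suc m ℓ (suc n) = begin
  F (m ℓ) + sumFrom m (suc ℓ) (suc n)                 ≡⟨ cong (λ z → F (m ℓ) + z) (sumFrom-suc m (suc ℓ) n) ⟩
  F (m ℓ) + (sumFrom m (suc ℓ) n + F (m (suc ℓ + n))) ≡⟨ +-assoc (F (m ℓ)) _ _ ⟨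
  sumFrom m ℓ (suc n) + F (m (suc ℓ + n))             ≡⟨ cong (λ i → sumFrom m ℓ (suc n) + F (m i)) (+-suc ℓ n) ⟨
  sumFrom m ℓ (suc n) + F (m (ℓ + suc n))             ∎
  where open ≡-Reasoning

sumF≡sumFrom : ∀ m k → sumF m k ≡ sumFrom m 0 (suc k)
sumF≡sumFrom m zero    = sym (+-identityʳ _)
sumF≡sumFrom m (suc k) = trans (cong (_+ F (m (suc k))) (sumF≡sumFrom m k)) (sym (sumFrom-suc m 0 (suc k)))

module ZeckendorfTails (m : ℕ → ℕ) (k : ℕ)
                       (gap : ∀ i → i < k → m (suc i) + 2 ≤ m i) (2≤m[k] : 2 ≤ m k) where

  tail : ℕ → ℕ
  tail ℓ = sumFrom m ℓ (suc k ∸ ℓ)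

  2≤m : ∀ i → i ≤ k → 2 ≤ m i
  2≤m i i≤k with m≤n⇒m<n∨m≡n i≤k
  ... | inj₁ i<k  = ≤-trans (m≤n+m 2 _) (gap i i<k)
  ... | inj₂ refl = 2≤m[k]

  tail-∷ : ∀ ℓ → ℓ ≤ k → tail ℓ ≡ F (m ℓ) + tail (suc ℓ)
  tail-∷ ℓ ℓ≤k = cong (sumFrom m ℓ) (+-∸-assoc 1 ℓ≤k)

  tail-end : tail (suc k) ≡ 0
  tail-end = cong (sumFrom m (suc k)) (n∸n≡0 k)

  tail-< : ∀ ℓ → ℓ ≤ k → tail (suc ℓ) < F (m ℓ ∸ 1)
  tail-< ℓ ℓ≤k = go (k ∸ ℓ) ℓ (m+[n∸m]≡n ℓ≤k)
    where
    go : ∀ n ℓ → ℓ + n ≡ k → sumFrom m (suc ℓ) n < F (m ℓ ∸ 1)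
    go zero    ℓ e = F[p∸1]>0 (2≤m ℓ (≤-reflexive (trans (sym (+-identityʳ ℓ)) e)))
    go (suc n) ℓ e = zeckendorf-step (m (suc ℓ)) (m ℓ) _ (2≤m (suc ℓ) 1+ℓ≤k) (gap ℓ 1+ℓ≤k) (go n (suc ℓ) e′)
      where
      e′ : suc ℓ + n ≡ k
      e′ = trans (sym (+-suc ℓ n)) e
      1+ℓ≤k : suc ℓ ≤ k
      1+ℓ≤k = ≤-trans (m≤m+n (suc ℓ) n) (≤-reflexive e′)

  R-tail-recurrence : ∀ ℓ → ℓ < k →
    + R (tail ℓ) ≡ t m (suc ℓ) ℤ.* + R (tail (suc ℓ)) ℤ.- ε m (suc ℓ) ℤ.* + R (tail (2 + ℓ))
  R-tail-recurrence ℓ ℓ<k = begin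
    + R (tail ℓ)
      ≡⟨ cong (λ n → + R n) (trans (tail-∷ ℓ (<⇒≤ ℓ<k)) (cong (λ z → F (m ℓ) + z) tail[1+ℓ])) ⟩
    + R (F (m ℓ) + (F (m (suc ℓ)) + tail (2 + ℓ)))
      ≡⟨ R-recurrence (m (suc ℓ)) (m ℓ) _ (2≤m (suc ℓ) ℓ<k) (gap ℓ ℓ<k) (tail-< (suc ℓ) ℓ<k) ⟩
    t m (suc ℓ) ℤ.* + R (F (m (suc ℓ)) + tail (2 + ℓ)) ℤ.- ε m (suc ℓ) ℤ.* + R (tail (2 + ℓ))
      ≡⟨ cong (λ n → t m (suc ℓ) ℤ.* + R n ℤ.- ε m (suc ℓ) ℤ.* + R (tail (2 + ℓ))) tail[1+ℓ] ⟨
    t m (suc ℓ) ℤ.* + R (tail (suc ℓ)) ℤ.- ε m (suc ℓ) ℤ.* + R (tail (2 + ℓ)) ∎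
    where
    open ≡-Reasoning
    tail[1+ℓ] : tail (suc ℓ) ≡ F (m (suc ℓ)) + tail (2 + ℓ)
    tail[1+ℓ] = tail-∷ (suc ℓ) ℓ<k

  R-tail-last : R (tail k) ≡ m k / 2
  R-tail-last = begin
    R (tail k)                 ≡⟨ cong R (tail-∷ k ≤-refl) ⟩
    R (F (m k) + tail (suc k)) ≡⟨ cong (λ n → R (F (m k) + n)) tail-end ⟩
    R (F (m k) + 0)            ≡⟨ cong R (+-identityʳ (F (m k))) ⟩
    R (F (m k))                ≡⟨ R-F (m k) 2≤m[k] ⟩
    m k / 2                    ∎
    where open ≡-Reasoning

theorem1p1 : (H k : ℕ) (m : ℕ → ℕ) →
    (∀ i → i < k → m (suc i) + 2 ≤ m i) →
    2 ≤ m k →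
    H ≡ sumF m k →
    + R H ≡ formula m k
theorem1p1 H k m gap 2≤m[k] refl = begin
  + R (sumF m k)
    ≡⟨ cong (λ n → + R n) (sumF≡sumFrom m k) ⟩
  + R (tail 0)
    ≡⟨ a-expansion m (λ ℓ → + R (tail ℓ)) k R-tail-recurrence ⟩
  a m k ℤ.* + R (tail k) ℤ.- ε m k ℤ.* a m (pred k) ℤ.* + R (tail (suc k))
    ≡⟨ cong₂ (λ u v → a m k ℤ.* + u ℤ.- ε m k ℤ.* a m (pred k) ℤ.* + R v) R-tail-last tail-end ⟩
  a m k ℤ.* + (m k / 2) ℤ.- ε m k ℤ.* a m (pred k) ℤ.* + 1
    ≡⟨ formula≡ m k ⟩
  formula m k ∎
  where
  open ≡-Reasoning
  open ZeckendorfTails m k gap 2≤m[k]
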